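{- The SL sentence $\varphi^{ord}=\varphi^{unb}\wedge\varphi^{trn}$ is satisfiable, where, over $\mathrm{AP}=\{p\}$ and $\mathrm{Ag}=\{\alpha,\beta\}$, $x_1<x_2$ abbreviates $\langle\langle y\rangle\rangle\big(((\alpha,x_1)(\beta,y)(\mathsf{X}p))\wedge((\alpha,x_2)(\beta,y)(\mathsf{X}\neg p))\big)$, $\varphi^{unb}=[\![x_1]\!]\langle\langle x_2\rangle\rangle\, x_1<x_2$, and $\varphi^{trn}=[\![x_1]\!][\![x_2]\!][\![x_3]\!]\,(x_1<x_2\wedge x_2<x_3)\rightarrow x_1<x_3$.
   Context: A concurrent game structure (CGS) $G=(\mathrm{AP},\mathrm{Ag},\mathrm{Ac},\mathrm{St},\lambda,\tau,s_0)$ has finite non-empty sets of atomic propositions and agents, countable non-empty sets of actions and states, initial state $s_0$, labeling $\lambda:\mathrm{St}\to2^{\mathrm{AP}}$ and transition function $\tau:\mathrm{St}\times\mathrm{Ac}^{\mathrm{Ag}}\to\mathrm{St}$. Strategies are maps from finite histories (tracks) of states to actions. SL semantics: $\langle\langle y\rangle\rangle$/$[\![x]\!]$ quantify existentially/universally over strategies assigned to the variable; $(a,x)$ makes agent $a$ use the strategy of $x$; once all agents are bound, temporal operators ($\mathsf{X}$ = next) are evaluated as in LTL on the unique play generated from the current state; $G\models\varphi$ iff $\varphi$ holds at $s_0$ under the empty assignment; a sentence is satisfiable if it has a model. -}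

module Defs where

open import Data.Nat using (ℕ; zero; suc; _<_; _≟_)
open import Data.Bool using (Bool; true; false)
open import Data.Maybe using (Maybe; just; nothing)
open import Data.Product using (Σ; _×_; _,_; ∃)
open import Data.Sum using (_⊎_)
open import Data.Empty using (⊥)
open import Data.List.NonEmpty using (List⁺; [_]; _⁺∷ʳ_; last)
open import Function.Bundles using (_↣_)
open import Relation.Binary.PropositionalEquality using (_≡_)
open import Relation.Nullary using (¬_; yes; no)

data AP : Set where
  p : AP

data Agent : Set where
  α β : Agent

_≟ᴬ_ : (a b : Agent) → Bool
α ≟ᴬ α = true
β ≟ᴬ β = true
α ≟ᴬ β = false
β ≟ᴬ α = false

-- Concurrent game structure over AP and Ag, with countable non-empty
-- sets of actions and states (countable = injects into ℕ).
record CGS : Set₁ where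
  field
    Ac      : Set
    St      : Set
    Ac-countable : Ac ↣ ℕ
    St-countable : St ↣ ℕ
    someAc  : Ac
    label   : St → AP → Bool
    τ       : St → (Agent → Ac) → St
    s₀      : St

Var : Set
Var = ℕ

data Formula : Set where
  atom   : AP → Formula
  ¬′_    : Formula → Formula
  _∧′_   : Formula → Formula → Formula
  _∨′_   : Formula → Formula → Formula
  _⇒′_   : Formula → Formula → Formula
  X′     : Formula → Formula
  _U′_   : Formula → Formula → Formula
  ⟪_⟫_   : Var → Formula → Formula
  ⟦_⟧_   : Var → Formula → Formula
  bind   : Agent → Var → Formula → Formula

module _ (G : CGS) where
  open CGS G

  Track : Set
  Track = List⁺ St

  Strategy : Set
  Strategy = Track → Ac

  record Asg : Set where
    constructor asg
    field
      var : Var → Maybe Strategy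
      agt : Agent → Maybe Strategy
  open Asg

  updVar : Asg → Var → Strategy → Asg
  updVar χ x σ = asg (λ y → Data.Bool.if ⌊ y ≟ x ⌋′ then just σ else var χ y) (agt χ)
    where
    ⌊_⌋′ : ∀ {P : Set} → Relation.Nullary.Dec P → Bool
    ⌊ yes _ ⌋′ = true
    ⌊ no _ ⌋′ = false

  updAgt : Asg → Agent → Strategy → Asg
  updAgt χ a σ = asg (var χ) (λ b → Data.Bool.if b ≟ᴬ a then just σ else agt χ b)

  step : (Agent → Strategy) → Track → Track
  step prof h = h ⁺∷ʳ τ (last h) (λ a → prof a h)

  extend : (Agent → Strategy) → Track → ℕ → Track
  extend prof h zero = h
  extend prof h (suc k) = step prof (extend prof h k)

  Complete : Asg → (Agent → Strategy) → Set
  Complete χ prof = (a : Agent) → agt χ a ≡ just (prof a)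

  -- satisfaction  G, χ, h ⊨ φ  (h the history, its last state the current state)
  Sat : Formula → Asg → Track → Set
  Sat (atom q) χ h = label (last h) q ≡ true
  Sat (¬′ φ) χ h = ¬ Sat φ χ h
  Sat (φ ∧′ ψ) χ h = Sat φ χ h × Sat ψ χ h
  Sat (φ ∨′ ψ) χ h = Sat φ χ h ⊎ Sat ψ χ h
  Sat (φ ⇒′ ψ) χ h = Sat φ χ h → Sat ψ χ h
  Sat (X′ φ) χ h = Σ (Agent → Strategy) λ prof → Complete χ prof × Sat φ χ (step prof h)
  Sat (φ U′ ψ) χ h = Σ (Agent → Strategy) λ prof → Complete χ prof ×
    ∃ λ k → Sat ψ χ (extend prof h k) × ((j : ℕ) → j < k → Sat φ χ (extend prof h j))
  Sat (⟪ x ⟫ φ) χ h = Σ Strategy λ σ → Sat φ (updVar χ x σ) h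
  Sat (⟦ x ⟧ φ) χ h = (σ : Strategy) → Sat φ (updVar χ x σ) h
  Sat (bind a x φ) χ h with var χ x
  ... | just σ = Sat φ (updAgt χ a σ) h
  ... | nothing = ⊥

  emptyAsg : Asg
  emptyAsg = asg (λ _ → nothing) (λ _ → nothing)

_⊨_ : CGS → Formula → Set
G ⊨ φ = Sat G φ (emptyAsg G) [ CGS.s₀ G ]

Satisfiable : Formula → Set₁
Satisfiable φ = Σ CGS λ G → G ⊨ φ

-- The specific sentence.  Variables: y = 0, x₁ = 1, x₂ = 2, x₃ = 3.
yv : Var
yv = 0

_≺_ : Var → Var → Formula
x₁ ≺ x₂ = ⟪ yv ⟫ (bind α x₁ (bind β yv (X′ (atom p)))
               ∧′ bind α x₂ (bind β yv (X′ (¬′ atom p))))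

φunb : Formula
φunb = ⟦ 1 ⟧ ⟪ 2 ⟫ (1 ≺ 2)

φtrn : Formula
φtrn = ⟦ 1 ⟧ ⟦ 2 ⟧ ⟦ 3 ⟧ (((1 ≺ 2) ∧′ (2 ≺ 3)) ⇒′ (1 ≺ 3))

φord : Formula
φord = φunb ∧′ φtrn

-- Take states Bool, with p true exactly in true, and actions ℕ, and let every
-- move lead to true exactly when α's action is below β's.  Hence x₁ ≺ x₂ holds iff the first action of x₁
-- is below that of x₂: the witness y must lie strictly above x₁ and weakly
-- below x₂, and y := x₂ always works.  So ≺ is the strict order of ℕ on first
-- actions, which is unbounded (take one more) and transitive.
module Submission where

open import Defs
open import Data.Nat using (ℕ; suc; _<_; _<ᵇ_)
open import Data.Nat.Properties using (<ᵇ⇒<; <⇒<ᵇ; <-irrefl; <-trans; <-≤-trans; ≮⇒≥; n<1+n)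
open import Data.Bool using (Bool; true; false)
open import Data.Bool.Properties using (T-≡)
open import Data.Maybe using (just)
open import Data.Maybe.Properties using (just-injective)
open import Data.Product using (_,_)
open import Data.List.NonEmpty using ([_]; _⁺∷ʳ_)
open import Function.Base using (_∘_)
open import Function.Bundles using (_↣_; _⇔_; mk↣; mk⇔; Equivalence)
open import Function.Construct.Identity using (↣-id)
open import Relation.Binary.PropositionalEquality using (_≡_; refl; sym; trans; cong₂; cong-app; subst)
open import Relation.Nullary using (¬_)
open import Function.Properties.Equivalence using () renaming (refl to ⇔-refl; trans to ⇔-trans)

open Asg

module _ (G : CGS) where

  bind⇔ : ∀ {h x σ} χ a φ → var χ x ≡ just σ →
          Sat G (bind a x φ) χ h ⇔ Sat G φ (updAgt G χ a σ) h
  bind⇔ χ a φ eq rewrite eq = ⇔-refl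

  complete-unique : ∀ {χ prof prof′} → Complete G χ prof → Complete G χ prof′ →
                    ∀ a → prof a ≡ prof′ a
  complete-unique c c′ a = just-injective (trans (sym (c a)) (c′ a))

Bool↣ℕ : Bool ↣ ℕ
Bool↣ℕ = mk↣ {to = toℕ} toℕ-injective
  where
  toℕ : Bool → ℕ
  toℕ false = 0
  toℕ true  = 1
  toℕ-injective : ∀ {b c} → toℕ b ≡ toℕ c → b ≡ c
  toℕ-injective {false} {false} _ = refl
  toℕ-injective {true}  {true}  _ = refl

Ord : CGS
Ord = record
  { Ac = ℕ ; St = Bool ; Ac-countable = ↣-id ℕ ; St-countable = Bool↣ℕ
  ; someAc = 0 ; label = λ s _ → s ; τ = λ _ d → d α <ᵇ d β ; s₀ = true }

profile : Strategy Ord → Strategy Ord → Agent → Strategy Ord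
profile σ ρ α = σ
profile σ ρ β = ρ

<ᵇ≡true⇔< : ∀ m n → (m <ᵇ n) ≡ true ⇔ m < n
<ᵇ≡true⇔< m n = mk⇔ (<ᵇ⇒< m n ∘ Equivalence.from T-≡) (Equivalence.to T-≡ ∘ <⇒<ᵇ)

X⇔ : ∀ {χ prof} {h : Track Ord} φ → Complete Ord χ prof →
     Sat Ord (X′ φ) χ h ⇔ Sat Ord φ χ (step Ord prof h)
X⇔ {χ} {prof} {h} φ c = mk⇔ to (λ s → prof , c , s)
  where
  agree : ∀ {prof′} → Complete Ord χ prof′ → ∀ a → prof′ a h ≡ prof a h
  agree c′ a = cong-app (complete-unique Ord {χ} c′ c a) h
  to : Sat Ord (X′ φ) χ h → Sat Ord φ χ (step Ord prof h)
  to (prof′ , c′ , s) =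
    subst (Sat Ord φ χ) (cong₂ (λ m n → h ⁺∷ʳ (m <ᵇ n)) (agree c′ α) (agree c′ β)) s

plays⇔ : ∀ {χ x y σ υ} {h : Track Ord} φ → var χ x ≡ just σ → var χ y ≡ just υ →
         Sat Ord (bind α x (bind β y (X′ φ))) χ h
           ⇔ Sat Ord φ (updAgt Ord (updAgt Ord χ α σ) β υ) (step Ord (profile σ υ) h)
plays⇔ {χ} {x} {y} {σ} {υ} {h} φ vx vy =
  ⇔-trans (bind⇔ Ord χ α (bind β y (X′ φ)) vx)
          (⇔-trans (bind⇔ Ord (updAgt Ord χ α σ) β (X′ φ) vy) (X⇔ {h = h} φ (complete {χ})))
  where
  complete : ∀ {χ} → Complete Ord (updAgt Ord (updAgt Ord χ α σ) β υ) (profile σ υ)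
  complete α = refl
  complete β = refl

-- Only one-state histories [ s ]: there last (h ⁺∷ʳ t) computes to t.
α-wins⇔ : ∀ {χ x y σ υ s} → var χ x ≡ just σ → var χ y ≡ just υ →
          Sat Ord (bind α x (bind β y (X′ (atom p)))) χ [ s ] ⇔ σ [ s ] < υ [ s ]
α-wins⇔ {χ} {σ = σ} {υ} {s} vx vy =
  ⇔-trans (plays⇔ {χ} {h = [ s ]} (atom p) vx vy) (<ᵇ≡true⇔< (σ [ s ]) (υ [ s ]))

α-loses⇔ : ∀ {χ x y σ υ s} → var χ x ≡ just σ → var χ y ≡ just υ →
           Sat Ord (bind α x (bind β y (X′ (¬′ atom p)))) χ [ s ] ⇔ (¬ σ [ s ] < υ [ s ])
α-loses⇔ {χ} {σ = σ} {υ} {s} vx vy =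
  ⇔-trans (plays⇔ {χ} {h = [ s ]} (¬′ atom p) vx vy) (mk⇔ (_∘ Equivalence.from wins) (_∘ Equivalence.to wins))
  where wins = <ᵇ≡true⇔< (σ [ s ]) (υ [ s ])

≺⇔ : ∀ {χ s i j σ ρ} → var χ (suc i) ≡ just σ → var χ (suc j) ≡ just ρ →
     Sat Ord (suc i ≺ suc j) χ [ s ] ⇔ σ [ s ] < ρ [ s ]
≺⇔ {χ} {s} {i} {j} {σ} {ρ} vi vj = mk⇔ to from
  where
  to : Sat Ord (suc i ≺ suc j) χ [ s ] → σ [ s ] < ρ [ s ]
  to (υ , σ<υ , ρ≮υ) =
    <-≤-trans (Equivalence.to (α-wins⇔ {updVar Ord χ yv υ} {suc i} {yv} vi refl) σ<υ)
              (≮⇒≥ (Equivalence.to (α-loses⇔ {updVar Ord χ yv υ} {suc j} {yv} vj refl) ρ≮υ))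
  from : σ [ s ] < ρ [ s ] → Sat Ord (suc i ≺ suc j) χ [ s ]
  from σ<ρ = ρ , Equivalence.from (α-wins⇔ {updVar Ord χ yv ρ} {suc i} {yv} vi refl) σ<ρ
               , Equivalence.from (α-loses⇔ {updVar Ord χ yv ρ} {suc j} {yv} vj refl) (<-irrefl refl)

lemma3p2 : Satisfiable φord
lemma3p2 = Ord , unbounded , transitive
  where
  χ₂ : Strategy Ord → Strategy Ord → Asg Ord
  χ₂ σ₁ σ₂ = updVar Ord (updVar Ord (emptyAsg Ord) 1 σ₁) 2 σ₂
  unbounded : Ord ⊨ φunb
  unbounded σ = suc ∘ σ ,
    Equivalence.from (≺⇔ {χ₂ σ (suc ∘ σ)} {true} {0} {1} refl refl) (n<1+n (σ [ true ]))
  transitive : Ord ⊨ φtrn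
  transitive σ₁ σ₂ σ₃ (σ₁≺σ₂ , σ₂≺σ₃) = Equivalence.from (≺⇔ {χ} {true} {0} {2} refl refl)
    (<-trans (Equivalence.to (≺⇔ {χ} {true} {0} {1} refl refl) σ₁≺σ₂)
             (Equivalence.to (≺⇔ {χ} {true} {1} {2} refl refl) σ₂≺σ₃))
    where χ = updVar Ord (χ₂ σ₁ σ₂) 3 σ₃
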